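{- As formal power series in $x$, $$(c_2 c_3+c_3 c_1+c_1 c_2) (e^{\alpha x}+e^{\beta x}+ e^{\gamma x})=\frac{ -1}{22}\sum_{k=0}^\infty T_k^{(3,1,3)}\frac{x^k}{k!}.$$
   Context: Let $\alpha,\beta,\gamma$ be the three distinct complex roots of $x^3-x^2-x-1=0$, and set $c_1=\frac{\alpha}{(\alpha-\beta)(\alpha-\gamma)}$, $c_2=\frac{\beta}{(\beta-\alpha)(\beta-\gamma)}$, $c_3=\frac{\gamma}{(\gamma-\alpha)(\gamma-\beta)}$. For numbers $s_0,s_1,s_2$, the sequence $T_k^{(s_0,s_1,s_2)}$ is defined by $T_0^{(s_0,s_1,s_2)}=s_0$, $T_1^{(s_0,s_1,s_2)}=s_1$, $T_2^{(s_0,s_1,s_2)}=s_2$ and $T_k^{(s_0,s_1,s_2)}=T_{k-1}^{(s_0,s_1,s_2)}+T_{k-2}^{(s_0,s_1,s_2)}+T_{k-3}^{(s_0,s_1,s_2)}$ for $k\ge3$. -}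

module Defs where

open import Level using (Level; suc; _⊔_)
open import Data.Nat using (ℕ; zero) renaming (suc to 1+)
open import Data.Nat using (_!)
open import Algebra.Bundles using (CommutativeRing)
open import Relation.Nullary using (¬_)

-- A field: a commutative ring with 0 ≠ 1 and a (total) inverse operation
-- that is a genuine multiplicative inverse on nonzero elements
-- (the value of 0⁻¹ is irrelevant, as in Mathlib).
record Field (c ℓ : Level) : Set (Level.suc (c ⊔ ℓ)) where
  field
    commutativeRing : CommutativeRing c ℓ
  open CommutativeRing commutativeRing public
  field
    _⁻¹      : Carrier → Carrier
    0≉1      : ¬ (0# ≈ 1#)
    inverseʳ : ∀ x → ¬ (x ≈ 0#) → x * (x ⁻¹) ≈ 1#

module FieldDefs {c ℓ : Level} (F : Field c ℓ) where
  open Field F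

  infixr 8 _^_
  infixl 7 _/_
  infixr 7 _·ₚ_
  infixl 6 _+ₚ_
  infix 4 _≈ₚ_

  ι : ℕ → Carrier
  ι zero   = 0#
  ι (1+ n) = 1# + ι n

  _^_ : Carrier → ℕ → Carrier
  x ^ zero   = 1#
  x ^ (1+ n) = x * (x ^ n)

  _/_ : Carrier → Carrier → Carrier
  x / y = x * (y ⁻¹)

  CharZero : Set ℓ
  CharZero = ∀ n → ¬ (ι (1+ n) ≈ 0#)

  T : Carrier → Carrier → Carrier → ℕ → Carrier
  T s0 s1 s2 0 = s0
  T s0 s1 s2 1 = s1
  T s0 s1 s2 2 = s2
  T s0 s1 s2 (1+ (1+ (1+ k))) =
    T s0 s1 s2 (1+ (1+ k)) + T s0 s1 s2 (1+ k) + T s0 s1 s2 k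

  -- Formal power series in x, as their coefficient sequences
  -- (coefficient of x^k), with coefficientwise equality.
  FPS : Set c
  FPS = ℕ → Carrier

  _≈ₚ_ : FPS → FPS → Set ℓ
  f ≈ₚ g = ∀ k → f k ≈ g k

  _+ₚ_ : FPS → FPS → FPS
  (f +ₚ g) k = f k + g k

  _·ₚ_ : Carrier → FPS → FPS
  (a ·ₚ f) k = a * f k

  expₚ : Carrier → FPS
  expₚ a k = (a ^ k) / ι (k !)

  egf : (ℕ → Carrier) → FPS
  egf s k = s k / ι (k !)

  cubic : Carrier → Carrier
  cubic a = a ^ 3 - a ^ 2 - a - 1#

-- Vieta's formulas for three distinct roots of x³ - x² - x - 1 read e₁ = 1, e₂ = -1, e₃ = 1.
-- Each root satisfies xᵏ⁺³ = xᵏ⁺² + xᵏ⁺¹ + xᵏ, so the power sums αᵏ + βᵏ + γᵏ form the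
-- tribonacci sequence with initial values 3, e₁ = 1 and e₁² - 2e₂ = 3.  With dᵢ the product of
-- the differences of the i-th root with the others (so cᵢ = αᵢ / dᵢ), the products
-- d₁d₂d₃ = -disc = 44 and (c₂c₃ + c₃c₁ + c₁c₂) d₁d₂d₃ = e₂² - 3e₁e₃ = -2 are symmetric, hence
-- computed from Vieta's formulas; so c₂c₃ + c₃c₁ + c₁c₂ = -1/22, and the identity holds
-- coefficientwise.
module Submission where

open import Level using (Level)
open import Function.Base using (_∘_)
open import Relation.Nullary using (¬_)
open import Relation.Binary.Consequences using (dec⇒weaklyDec)
import Relation.Binary.PropositionalEquality as ≡
import Relation.Binary.Reasoning.Setoid
open import Data.Nat using (ℕ; zero; suc)
import Data.Nat as ℕ
import Data.Nat.Properties as ℕ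
open import Data.Integer as ℤ using (ℤ; +_; -[1+_]; sign; ∣_∣; _◃_; _⊖_)
import Data.Integer.Properties as ℤ
open import Data.Sign as Sign using (Sign)
open import Data.Maybe.Base as Maybe using (Maybe)
open import Data.Fin using (#_)
open import Data.Vec.Base using (Vec; []; _∷_)
open import Data.Vec.Relation.Binary.Pointwise.Inductive as Pointwise using (Pointwise; []; _∷_)
open import Algebra.Bundles using (CommutativeRing)
open import Algebra.Solver.Ring.AlmostCommutativeRing
  using (fromCommutativeRing; _-Raw-AlmostCommutative⟶_)
open import Defs

module IntegerCoefficients {c ℓ : Level} (R : CommutativeRing c ℓ) where
  open CommutativeRing R
  open import Algebra.Properties.Semiring.Mult.TCOptimised semiring
    using (_×_; 1+×; ×-homo-+; ×1-homo-*)
  open import Algebra.Properties.Ring ring using (-1*x≈-x; -0#≈0#; -‿involutive; -‿+-comm)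
  open import Algebra.Properties.CommutativeSemigroup +-commutativeSemigroup
    using () renaming (interchange to +-interchange)
  open import Algebra.Properties.CommutativeSemigroup *-commutativeSemigroup
    using () renaming (interchange to *-interchange)
  open import Algebra.Properties.Semiring.Exp semiring using (^-congˡ)
  open import Relation.Binary.Reasoning.Setoid setoid

  fromSign : Sign → Carrier
  fromSign Sign.+ = 1#
  fromSign Sign.- = - 1#

  -- With the optimised multiple, the solver constant + 1 denotes 1# itself.
  fromℤ : ℤ → Carrier
  fromℤ (+ n)      = n × 1#
  fromℤ -[1+ n ]   = - (suc n × 1#)

  fromSign-* : ∀ s t → fromSign (s Sign.* t) ≈ fromSign s * fromSign t
  fromSign-* Sign.+ t      = sym (*-identityˡ _)
  fromSign-* Sign.- Sign.+ = sym (*-identityʳ _)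
  fromSign-* Sign.- Sign.- = sym (trans (-1*x≈-x _) (-‿involutive _))

  fromℤ-suc : ∀ n → fromℤ (+ suc n) ≈ 1# + fromℤ (+ n)
  fromℤ-suc n = 1+× n 1#

  fromℤ-◃ : ∀ s n → fromℤ (s ◃ n) ≈ fromSign s * (n × 1#)
  fromℤ-◃ s      zero    = sym (zeroʳ _)
  fromℤ-◃ Sign.+ (suc n) = sym (*-identityˡ _)
  fromℤ-◃ Sign.- (suc n) = sym (-1*x≈-x _)

  fromℤ-⊖ : ∀ m n → fromℤ (m ⊖ n) ≈ m × 1# - n × 1#
  fromℤ-⊖ m       zero    = begin
    fromℤ (m ⊖ 0)      ≡⟨ ≡.cong fromℤ (ℤ.≤-⊖ (ℕ.z≤n {m})) ⟩
    m × 1#             ≈⟨ +-identityʳ _ ⟨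
    m × 1# + 0#        ≈⟨ +-congˡ -0#≈0# ⟨
    m × 1# - 0#        ∎
  fromℤ-⊖ zero    (suc n) = begin
    fromℤ (0 ⊖ suc n)  ≡⟨ ≡.cong fromℤ (ℤ.⊖-< (ℕ.s≤s (ℕ.z≤n {n}))) ⟩
    - (suc n × 1#)     ≈⟨ +-identityˡ _ ⟨
    0# - suc n × 1#    ∎
  fromℤ-⊖ (suc m) (suc n) = begin
    fromℤ (suc m ⊖ suc n)           ≡⟨ ≡.cong fromℤ (ℤ.[1+m]⊖[1+n]≡m⊖n m n) ⟩
    fromℤ (m ⊖ n)                   ≈⟨ fromℤ-⊖ m n ⟩
    m × 1# - n × 1#                 ≈⟨ +-identityˡ _ ⟨
    0# + (m × 1# - n × 1#)          ≈⟨ +-congʳ (-‿inverseʳ 1#) ⟨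
    (1# - 1#) + (m × 1# - n × 1#)   ≈⟨ +-interchange _ _ _ _ ⟩
    (1# + m × 1#) + (- 1# - n × 1#) ≈⟨ +-congˡ (-‿+-comm 1# (n × 1#)) ⟩
    (1# + m × 1#) - (1# + n × 1#)   ≈⟨ +-cong (1+× m 1#) (-‿cong (1+× n 1#)) ⟨
    suc m × 1# - suc n × 1#         ∎

  fromℤ-+ : ∀ i j → fromℤ (i ℤ.+ j) ≈ fromℤ i + fromℤ j
  fromℤ-+ (+ m)    (+ n)    = ×-homo-+ 1# m n
  fromℤ-+ (+ m)    -[1+ n ] = fromℤ-⊖ m (suc n)
  fromℤ-+ -[1+ m ] (+ n)    = trans (fromℤ-⊖ n (suc m)) (+-comm _ _)
  fromℤ-+ -[1+ m ] -[1+ n ] = begin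
    - (suc (suc (m ℕ.+ n)) × 1#)        ≡⟨ ≡.cong (λ k → - (k × 1#)) (≡.sym (ℕ.+-suc (suc m) n)) ⟩
    - ((suc m ℕ.+ suc n) × 1#)          ≈⟨ -‿cong (×-homo-+ 1# (suc m) (suc n)) ⟩
    - (suc m × 1# + suc n × 1#)         ≈⟨ -‿+-comm _ _ ⟨
    - (suc m × 1#) + - (suc n × 1#)     ∎

  fromℤ-* : ∀ i j → fromℤ (i ℤ.* j) ≈ fromℤ i * fromℤ j
  fromℤ-* i j = begin
    fromℤ (sign i Sign.* sign j ◃ ∣ i ∣ ℕ.* ∣ j ∣)               ≈⟨ fromℤ-◃ (sign i Sign.* sign j) (∣ i ∣ ℕ.* ∣ j ∣) ⟩
    fromSign (sign i Sign.* sign j) * ((∣ i ∣ ℕ.* ∣ j ∣) × 1#)   ≈⟨ *-cong (fromSign-* (sign i) (sign j)) (×1-homo-* ∣ i ∣ ∣ j ∣) ⟩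
    (fromSign (sign i) * fromSign (sign j)) * (∣ i ∣ × 1# * ∣ j ∣ × 1#)
                                                              ≈⟨ *-interchange _ _ _ _ ⟩
    fromSign (sign i) * ∣ i ∣ × 1# * (fromSign (sign j) * ∣ j ∣ × 1#)
                                                              ≈⟨ *-cong (fromℤ-signAbs i) (fromℤ-signAbs j) ⟩
    fromℤ i * fromℤ j                                         ∎
    where
    fromℤ-signAbs : ∀ k → fromSign (sign k) * ∣ k ∣ × 1# ≈ fromℤ k
    fromℤ-signAbs k = trans (sym (fromℤ-◃ (sign k) ∣ k ∣)) (reflexive (≡.cong fromℤ (ℤ.◃-inverse k)))

  fromℤ-‿ : ∀ i → fromℤ (ℤ.- i) ≈ - fromℤ i
  fromℤ-‿ -[1+ n ]  = sym (-‿involutive _)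
  fromℤ-‿ (+ zero)  = sym -0#≈0#
  fromℤ-‿ (+ suc n) = refl

  homomorphism : ℤ.+-*-rawRing -Raw-AlmostCommutative⟶ fromCommutativeRing R
  homomorphism = record
    { ⟦_⟧    = fromℤ
    ; +-homo = fromℤ-+
    ; *-homo = fromℤ-*
    ; -‿homo = fromℤ-‿
    ; 0-homo = refl
    ; 1-homo = refl
    }

  fromℤ-≟ : ∀ i j → Maybe (fromℤ i ≈ fromℤ j)
  fromℤ-≟ i j = Maybe.map (reflexive ∘ ≡.cong fromℤ) (dec⇒weaklyDec ℤ._≟_ i j)

  open import Algebra.Solver.Ring ℤ.+-*-rawRing (fromCommutativeRing R) homomorphism fromℤ-≟ public

  ⟦⟧-cong : ∀ {n} (p : Polynomial n) {ρ σ : Vec Carrier n} → Pointwise _≈_ ρ σ → ⟦ p ⟧ ρ ≈ ⟦ p ⟧ σ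
  ⟦⟧-cong (op [+] p q) ρ≈σ = +-cong (⟦⟧-cong p ρ≈σ) (⟦⟧-cong q ρ≈σ)
  ⟦⟧-cong (op [*] p q) ρ≈σ = *-cong (⟦⟧-cong p ρ≈σ) (⟦⟧-cong q ρ≈σ)
  ⟦⟧-cong (con i)      ρ≈σ = refl
  ⟦⟧-cong (var i)      ρ≈σ = Pointwise.lookup ρ≈σ i
  ⟦⟧-cong (p :^ k)     ρ≈σ = ^-congˡ k (⟦⟧-cong p ρ≈σ)
  ⟦⟧-cong (:- p)       ρ≈σ = -‿cong (⟦⟧-cong p ρ≈σ)

module FieldLemmas {c ℓ : Level} (F : Field c ℓ) where
  open Field F
  open FieldDefs F
  open IntegerCoefficients commutativeRing
  open import Algebra.Properties.Ring ring using (-‿distribˡ-*; +-inverseˡ-unique; x∙y⁻¹≈ε⇒x≈y; x≈y⇒x∙y⁻¹≈ε; [y-z]x≈yx-zx)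
  open import Relation.Binary.Reasoning.Setoid setoid

  ι≈fromℤ : ∀ n → ι n ≈ fromℤ (+ n)
  ι≈fromℤ zero    = refl
  ι≈fromℤ (suc n) = trans (+-congˡ (ι≈fromℤ n)) (sym (fromℤ-suc n))

  x*y≈0⇒y≈0 : ∀ {x y} → ¬ x ≈ 0# → x * y ≈ 0# → y ≈ 0#
  x*y≈0⇒y≈0 {x} {y} x≉0 x*y≈0 = begin
    y                   ≈⟨ *-identityˡ y ⟨
    1# * y              ≈⟨ *-congʳ (inverseʳ x x≉0) ⟨
    (x * x ⁻¹) * y      ≈⟨ solve 3 (λ x x⁻¹ y → (x :* x⁻¹) :* y := x⁻¹ :* (x :* y)) refl x (x ⁻¹) y ⟩
    x ⁻¹ * (x * y)      ≈⟨ *-congˡ x*y≈0 ⟩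
    x ⁻¹ * 0#           ≈⟨ zeroʳ _ ⟩
    0#                  ∎

  x≉y⇒x-y≉0 : ∀ {x y} → ¬ x ≈ y → ¬ x - y ≈ 0#
  x≉y⇒x-y≉0 x≉y x-y≈0 = x≉y (x∙y⁻¹≈ε⇒x≈y _ _ x-y≈0)

  x≉0∧y≉0⇒x*y≉0 : ∀ {x y} → ¬ x ≈ 0# → ¬ y ≈ 0# → ¬ x * y ≈ 0#
  x≉0∧y≉0⇒x*y≉0 x≉0 y≉0 x*y≈0 = y≉0 (x*y≈0⇒y≈0 x≉0 x*y≈0)

  *-cancelʳ-≉0 : ∀ {x y z} → ¬ z ≈ 0# → x * z ≈ y * z → x ≈ y
  *-cancelʳ-≉0 {x} {y} {z} z≉0 xz≈yz = x∙y⁻¹≈ε⇒x≈y x y (x*y≈0⇒y≈0 z≉0 (begin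
    z * (x - y)     ≈⟨ *-comm z (x - y) ⟩
    (x - y) * z     ≈⟨ [y-z]x≈yx-zx z x y ⟩
    x * z - y * z   ≈⟨ +-congʳ xz≈yz ⟩
    y * z - y * z   ≈⟨ -‿inverseʳ (y * z) ⟩
    0#              ∎))

  x*y≈z⇒x≈z/y : ∀ {x y z} → ¬ y ≈ 0# → x * y ≈ z → x ≈ z / y
  x*y≈z⇒x≈z/y {x} {y} {z} y≉0 x*y≈z = begin
    x                ≈⟨ *-identityʳ x ⟨
    x * 1#           ≈⟨ *-congˡ (inverseʳ y y≉0) ⟨
    x * (y * y ⁻¹)   ≈⟨ *-assoc x y (y ⁻¹) ⟨
    x * y * y ⁻¹     ≈⟨ *-congʳ x*y≈z ⟩
    z / y            ∎

  x/y*y≈x : ∀ {x y} → ¬ y ≈ 0# → x / y * y ≈ x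
  x/y*y≈x {x} {y} y≉0 = begin
    x * y ⁻¹ * y     ≈⟨ *-assoc x (y ⁻¹) y ⟩
    x * (y ⁻¹ * y)   ≈⟨ *-congˡ (trans (*-comm (y ⁻¹) y) (inverseʳ y y≉0)) ⟩
    x * 1#           ≈⟨ *-identityʳ x ⟩
    x                ∎

  ≈+≈0⇒≈ : ∀ {x y z} → x ≈ y + z → z ≈ 0# → x ≈ y
  ≈+≈0⇒≈ {y = y} x≈y+z z≈0 = trans x≈y+z (trans (+-congˡ z≈0) (+-identityʳ y))

  IsTribonacci : (ℕ → Carrier) → Set ℓ
  IsTribonacci s = ∀ k → s (3 ℕ.+ k) ≈ s (2 ℕ.+ k) + s (1 ℕ.+ k) + s k

  tribonacci≈T : ∀ {s t₀ t₁ t₂} → IsTribonacci s →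
                 s 0 ≈ t₀ → s 1 ≈ t₁ → s 2 ≈ t₂ → ∀ k → s k ≈ T t₀ t₁ t₂ k
  tribonacci≈T {s} {t₀} {t₁} {t₂} rec s₀≈t₀ s₁≈t₁ s₂≈t₂ = go
    where
    go : ∀ k → s k ≈ T t₀ t₁ t₂ k
    go 0                   = s₀≈t₀
    go 1                   = s₁≈t₁
    go 2                   = s₂≈t₂
    go (suc (suc (suc k))) = trans (rec k) (+-cong (+-cong (go (suc (suc k))) (go (suc k))) (go k))

  tribonacci-+ : ∀ {s t} → IsTribonacci s → IsTribonacci t → IsTribonacci (λ k → s k + t k)
  tribonacci-+ {s} {t} s-rec t-rec k = begin
    s (3 ℕ.+ k) + t (3 ℕ.+ k)
      ≈⟨ +-cong (s-rec k) (t-rec k) ⟩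
    (s (2 ℕ.+ k) + s (1 ℕ.+ k) + s k) + (t (2 ℕ.+ k) + t (1 ℕ.+ k) + t k)
      ≈⟨ solve 6 (λ s₂ s₁ s₀ t₂ t₁ t₀ → (s₂ :+ s₁ :+ s₀) :+ (t₂ :+ t₁ :+ t₀)
                                     := (s₂ :+ t₂) :+ (s₁ :+ t₁) :+ (s₀ :+ t₀))
              refl (s (2 ℕ.+ k)) (s (1 ℕ.+ k)) (s k) (t (2 ℕ.+ k)) (t (1 ℕ.+ k)) (t k) ⟩
    (s (2 ℕ.+ k) + t (2 ℕ.+ k)) + (s (1 ℕ.+ k) + t (1 ℕ.+ k)) + (s k + t k) ∎

  cubicₚ : ∀ {n} → Polynomial n → Polynomial n
  cubicₚ x = x :* (x :* (x :* con (+ 1))) :- x :* (x :* con (+ 1)) :- x :- con (+ 1)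

  ^-tribonacci : ∀ {x} → cubic x ≈ 0# → IsTribonacci (x ^_)
  ^-tribonacci {x} x-root k = ≈+≈0⇒≈
    (solve 2 (λ x xᵏ → x :* (x :* (x :* xᵏ))
                      := x :* (x :* xᵏ) :+ x :* xᵏ :+ xᵏ
                         :+ cubicₚ x :* xᵏ)
           refl x (x ^ k))
    (trans (*-congʳ x-root) (zeroˡ (x ^ k)))

  dividedDifference : Carrier → Carrier → Carrier
  dividedDifference x y = x * x + x * y + y * y - x - y - 1#

  dividedDifferenceₚ : ∀ {n} → Polynomial n → Polynomial n → Polynomial n
  dividedDifferenceₚ x y = x :* x :+ x :* y :+ y :* y :- x :- y :- con (+ 1)

  dividedDifference≈0 : ∀ {x y} → ¬ x ≈ y → cubic x ≈ 0# → cubic y ≈ 0# → dividedDifference x y ≈ 0#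
  dividedDifference≈0 {x} {y} x≉y x-root y-root = x*y≈0⇒y≈0 (x≉y⇒x-y≉0 x≉y) (begin
    (x - y) * dividedDifference x y
      ≈⟨ solve 2 (λ x y → (x :- y) :* dividedDifferenceₚ x y := cubicₚ x :- cubicₚ y) refl x y ⟩
    cubic x - cubic y   ≈⟨ +-cong x-root (-‿cong y-root) ⟩
    0# - 0#             ≈⟨ -‿inverseʳ 0# ⟩
    0#                  ∎)

  module DistinctRoots (α β γ : Carrier)
    (α-root : cubic α ≈ 0#) (β-root : cubic β ≈ 0#) (γ-root : cubic γ ≈ 0#)
    (α≉β : ¬ α ≈ β) (β≉γ : ¬ β ≈ γ) (α≉γ : ¬ α ≈ γ) where

    e₁ e₂ e₃ : Carrier
    e₁ = α + β + γ
    e₂ = α * β + β * γ + γ * α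
    e₃ = α * β * γ

    Op₃ : Set
    Op₃ = ∀ {n} → Polynomial n → Polynomial n → Polynomial n → Polynomial n

    e₁ₚ e₂ₚ e₃ₚ : Op₃
    e₁ₚ a b g = a :+ b :+ g
    e₂ₚ a b g = a :* b :+ b :* g :+ g :* a
    e₃ₚ a b g = a :* b :* g

    vieta₁ : e₁ ≈ 1#
    vieta₁ = x∙y⁻¹≈ε⇒x≈y e₁ 1# (x*y≈0⇒y≈0 (x≉y⇒x-y≉0 β≉γ) (begin
      (β - γ) * (e₁ - 1#)
        ≈⟨ solve 3 (λ a b g → (b :- g) :* (e₁ₚ a b g :- con (+ 1))
                            := dividedDifferenceₚ a b :- dividedDifferenceₚ a g) refl α β γ ⟩
      dividedDifference α β - dividedDifference α γ
        ≈⟨ +-cong (dividedDifference≈0 α≉β α-root β-root) (-‿cong (dividedDifference≈0 α≉γ α-root γ-root)) ⟩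
      0# - 0#
        ≈⟨ -‿inverseʳ 0# ⟩
      0# ∎))

    e₁-1≈0 : e₁ - 1# ≈ 0#
    e₁-1≈0 = x≈y⇒x∙y⁻¹≈ε vieta₁

    e₂+1≈0 : e₂ + 1# ≈ 0#
    e₂+1≈0 = begin
      e₂ + 1#
        ≈⟨ solve 3 (λ a b g → e₂ₚ a b g :+ con (+ 1)
                            := (e₁ₚ a b g :- con (+ 1)) :* (a :+ b) :- dividedDifferenceₚ a b) refl α β γ ⟩
      (e₁ - 1#) * (α + β) - dividedDifference α β
        ≈⟨ +-cong (*-congʳ e₁-1≈0) (-‿cong (dividedDifference≈0 α≉β α-root β-root)) ⟩
      0# * (α + β) - 0#
        ≈⟨ solve 1 (λ x → con (+ 0) :* x :- con (+ 0) := con (+ 0)) refl (α + β) ⟩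
      0# ∎

    vieta₂ : e₂ ≈ - 1#
    vieta₂ = +-inverseˡ-unique e₂ 1# e₂+1≈0

    vieta₃ : e₃ ≈ 1#
    vieta₃ = x∙y⁻¹≈ε⇒x≈y e₃ 1# (begin
      e₃ - 1#
        ≈⟨ solve 3 (λ a b g → e₃ₚ a b g :- con (+ 1)
                            := cubicₚ a :- (e₁ₚ a b g :- con (+ 1)) :* (a :* a)
                               :+ (e₂ₚ a b g :+ con (+ 1)) :* a) refl α β γ ⟩
      cubic α - (e₁ - 1#) * (α * α) + (e₂ + 1#) * α
        ≈⟨ +-cong (+-cong α-root (-‿cong (*-congʳ e₁-1≈0))) (*-congʳ e₂+1≈0) ⟩
      0# - 0# * (α * α) + 0# * α
        ≈⟨ solve 2 (λ x y → con (+ 0) :- con (+ 0) :* x :+ con (+ 0) :* y := con (+ 0)) refl (α * α) α ⟩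
      0# ∎)

    x₁ x₂ x₃ : Polynomial 3
    x₁ = var (# 0)
    x₂ = var (# 1)
    x₃ = var (# 2)

    evaluate-at-vieta : (p : Polynomial 3) → ⟦ p ⟧ (e₁ ∷ e₂ ∷ e₃ ∷ []) ≈ ⟦ p ⟧ (1# ∷ - 1# ∷ 1# ∷ [])
    evaluate-at-vieta p = ⟦⟧-cong p (vieta₁ ∷ vieta₂ ∷ vieta₃ ∷ [])

    powerSum : ℕ → Carrier
    powerSum k = α ^ k + β ^ k + γ ^ k

    powerSum≈T : ∀ k → powerSum k ≈ T (ι 3) (ι 1) (ι 3) k
    powerSum≈T = tribonacci≈T
      (tribonacci-+ (tribonacci-+ (^-tribonacci α-root) (^-tribonacci β-root)) (^-tribonacci γ-root))
      (sym (ι≈fromℤ 3))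
      (begin
        α * 1# + β * 1# + γ * 1# ≈⟨ solve 3 (λ a b g → a :* con (+ 1) :+ b :* con (+ 1) :+ g :* con (+ 1) := e₁ₚ a b g) refl α β γ ⟩
        e₁                       ≈⟨ vieta₁ ⟩
        1#                       ≈⟨ ι≈fromℤ 1 ⟨
        ι 1                      ∎)
      (begin
        powerSum 2
          ≈⟨ solve 3 (λ a b g → a :* (a :* con (+ 1)) :+ b :* (b :* con (+ 1)) :+ g :* (g :* con (+ 1))
                              := p₂ (e₁ₚ a b g) (e₂ₚ a b g) (e₃ₚ a b g)) refl α β γ ⟩
        ⟦ p₂ x₁ x₂ x₃ ⟧ (e₁ ∷ e₂ ∷ e₃ ∷ [])
          ≈⟨ evaluate-at-vieta (p₂ x₁ x₂ x₃) ⟩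
        ⟦ p₂ x₁ x₂ x₃ ⟧ (1# ∷ - 1# ∷ 1# ∷ [])
          ≈⟨ solve 0 (p₂ (con (+ 1)) (con -[1+ 0 ]) (con (+ 1)) := con (+ 3)) refl ⟩
        fromℤ (+ 3)
          ≈⟨ ι≈fromℤ 3 ⟨
        ι 3 ∎)
      where
      p₂ : Op₃
      p₂ y₁ y₂ y₃ = y₁ :* y₁ :- con (+ 2) :* y₂

    d₁ d₂ d₃ : Carrier
    d₁ = (α - β) * (α - γ)
    d₂ = (β - α) * (β - γ)
    d₃ = (γ - α) * (γ - β)

    d₁≉0 : ¬ d₁ ≈ 0#
    d₁≉0 = x≉0∧y≉0⇒x*y≉0 (x≉y⇒x-y≉0 α≉β) (x≉y⇒x-y≉0 α≉γ)

    d₂≉0 : ¬ d₂ ≈ 0#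
    d₂≉0 = x≉0∧y≉0⇒x*y≉0 (x≉y⇒x-y≉0 (α≉β ∘ sym)) (x≉y⇒x-y≉0 β≉γ)

    d₃≉0 : ¬ d₃ ≈ 0#
    d₃≉0 = x≉0∧y≉0⇒x*y≉0 (x≉y⇒x-y≉0 (α≉γ ∘ sym)) (x≉y⇒x-y≉0 (β≉γ ∘ sym))

    -- d₁ d₂ d₃ is minus the discriminant, here written in terms of e₁, e₂, e₃.
    d₁*d₂*d₃≈44 : d₁ * (d₂ * d₃) ≈ fromℤ (+ 44)
    d₁*d₂*d₃≈44 = begin
      d₁ * (d₂ * d₃)
        ≈⟨ solve 3 (λ a b g → (a :- b) :* (a :- g) :* ((b :- a) :* (b :- g) :* ((g :- a) :* (g :- b)))
                            := Δ (e₁ₚ a b g) (e₂ₚ a b g) (e₃ₚ a b g)) refl α β γ ⟩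
      ⟦ Δ x₁ x₂ x₃ ⟧ (e₁ ∷ e₂ ∷ e₃ ∷ [])
        ≈⟨ evaluate-at-vieta (Δ x₁ x₂ x₃) ⟩
      ⟦ Δ x₁ x₂ x₃ ⟧ (1# ∷ - 1# ∷ 1# ∷ [])
        ≈⟨ solve 0 (Δ (con (+ 1)) (con -[1+ 0 ]) (con (+ 1)) := con (+ 44)) refl ⟩
      fromℤ (+ 44) ∎
      where
      Δ : Op₃
      Δ y₁ y₂ y₃ = :- (y₁ :* y₁ :* y₂ :* y₂) :+ con (+ 4) :* y₂ :* y₂ :* y₂ :+ con (+ 4) :* y₁ :* y₁ :* y₁ :* y₃
                   :- con (+ 18) :* y₁ :* y₂ :* y₃ :+ con (+ 27) :* y₃ :* y₃

    numerator≈-2 : β * γ * d₁ + γ * α * d₂ + α * β * d₃ ≈ fromℤ -[1+ 1 ]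
    numerator≈-2 = begin
      β * γ * d₁ + γ * α * d₂ + α * β * d₃
        ≈⟨ solve 3 (λ a b g → b :* g :* ((a :- b) :* (a :- g)) :+ g :* a :* ((b :- a) :* (b :- g))
                              :+ a :* b :* ((g :- a) :* (g :- b))
                            := ν (e₁ₚ a b g) (e₂ₚ a b g) (e₃ₚ a b g)) refl α β γ ⟩
      ⟦ ν x₁ x₂ x₃ ⟧ (e₁ ∷ e₂ ∷ e₃ ∷ [])
        ≈⟨ evaluate-at-vieta (ν x₁ x₂ x₃) ⟩
      ⟦ ν x₁ x₂ x₃ ⟧ (1# ∷ - 1# ∷ 1# ∷ [])
        ≈⟨ solve 0 (ν (con (+ 1)) (con -[1+ 0 ]) (con (+ 1)) := con -[1+ 1 ]) refl ⟩
      fromℤ -[1+ 1 ] ∎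
      where
      ν : Op₃
      ν y₁ y₂ y₃ = y₂ :* y₂ :- con (+ 3) :* y₁ :* y₃

    c₁ c₂ c₃ e₂[c] : Carrier
    c₁ = α / d₁
    c₂ = β / d₂
    c₃ = γ / d₃
    e₂[c] = c₂ * c₃ + c₃ * c₁ + c₁ * c₂

    e₂[c]*d₁*d₂*d₃≈numerator : e₂[c] * (d₁ * (d₂ * d₃)) ≈ β * γ * d₁ + γ * α * d₂ + α * β * d₃
    e₂[c]*d₁*d₂*d₃≈numerator = begin
      e₂[c] * (d₁ * (d₂ * d₃))
        ≈⟨ solve 6 (λ c₁ c₂ c₃ d₁ d₂ d₃ → (c₂ :* c₃ :+ c₃ :* c₁ :+ c₁ :* c₂) :* (d₁ :* (d₂ :* d₃))
                    := c₂ :* d₂ :* (c₃ :* d₃) :* d₁ :+ c₃ :* d₃ :* (c₁ :* d₁) :* d₂ :+ c₁ :* d₁ :* (c₂ :* d₂) :* d₃)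
                   refl c₁ c₂ c₃ d₁ d₂ d₃ ⟩
      c₂ * d₂ * (c₃ * d₃) * d₁ + c₃ * d₃ * (c₁ * d₁) * d₂ + c₁ * d₁ * (c₂ * d₂) * d₃
        ≈⟨ +-cong (+-cong (*-congʳ (*-cong c₂d₂≈β c₃d₃≈γ)) (*-congʳ (*-cong c₃d₃≈γ c₁d₁≈α)))
                  (*-congʳ (*-cong c₁d₁≈α c₂d₂≈β)) ⟩
      β * γ * d₁ + γ * α * d₂ + α * β * d₃ ∎
      where
      c₁d₁≈α : c₁ * d₁ ≈ α
      c₁d₁≈α = x/y*y≈x d₁≉0
      c₂d₂≈β : c₂ * d₂ ≈ β
      c₂d₂≈β = x/y*y≈x d₂≉0
      c₃d₃≈γ : c₃ * d₃ ≈ γ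
      c₃d₃≈γ = x/y*y≈x d₃≉0

    e₂[c]≈-1/22 : CharZero → e₂[c] ≈ - (1# / ι 22)
    e₂[c]≈-1/22 charZero = begin
      e₂[c]           ≈⟨ x*y≈z⇒x≈z/y (charZero 21) (*-cancelʳ-≉0 (charZero 1) e₂[c]*22*2≈-2) ⟩
      - 1# / ι 22     ≈⟨ -‿distribˡ-* 1# (ι 22 ⁻¹) ⟨
      - (1# / ι 22)   ∎
      where
      e₂[c]*22*2≈-2 : e₂[c] * ι 22 * ι 2 ≈ - 1# * ι 2
      e₂[c]*22*2≈-2 = begin
        e₂[c] * ι 22 * ι 2
          ≈⟨ *-cong (*-congˡ (ι≈fromℤ 22)) (ι≈fromℤ 2) ⟩
        e₂[c] * fromℤ (+ 22) * fromℤ (+ 2)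
          ≈⟨ solve 1 (λ s → s :* con (+ 22) :* con (+ 2) := s :* con (+ 44)) refl e₂[c] ⟩
        e₂[c] * fromℤ (+ 44)             ≈⟨ *-congˡ d₁*d₂*d₃≈44 ⟨
        e₂[c] * (d₁ * (d₂ * d₃))         ≈⟨ e₂[c]*d₁*d₂*d₃≈numerator ⟩
        β * γ * d₁ + γ * α * d₂ + α * β * d₃ ≈⟨ numerator≈-2 ⟩
        fromℤ -[1+ 1 ]
          ≈⟨ solve 0 (con -[1+ 1 ] := :- con (+ 1) :* con (+ 2)) refl ⟩
        - 1# * fromℤ (+ 2)               ≈⟨ *-congˡ (ι≈fromℤ 2) ⟨
        - 1# * ι 2                       ∎

corollary1 : ∀ {c ℓ : Level} (F : Field c ℓ) → let open Field F in let open FieldDefs F in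
    CharZero →
    (α β γ : Carrier) →
    cubic α ≈ 0# → cubic β ≈ 0# → cubic γ ≈ 0# →
    ¬ (α ≈ β) → ¬ (β ≈ γ) → ¬ (α ≈ γ) →
    let c₁ = α / ((α - β) * (α - γ))
        c₂ = β / ((β - α) * (β - γ))
        c₃ = γ / ((γ - α) * (γ - β))
    in ((c₂ * c₃ + c₃ * c₁ + c₁ * c₂) ·ₚ (expₚ α +ₚ expₚ β +ₚ expₚ γ))
       ≈ₚ ((- (1# / ι 22)) ·ₚ egf (T (ι 3) (ι 1) (ι 3)))
corollary1 F charZero α β γ α-root β-root γ-root α≉β β≉γ α≉γ k = begin
  e₂[c] * (α ^ k * k!⁻¹ + β ^ k * k!⁻¹ + γ ^ k * k!⁻¹)
    ≈⟨ *-congˡ (trans (+-congʳ (sym (distribʳ _ _ _))) (sym (distribʳ _ _ _))) ⟩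
  e₂[c] * (powerSum k * k!⁻¹)
    ≈⟨ *-cong (e₂[c]≈-1/22 charZero) (*-congʳ (powerSum≈T k)) ⟩
  - (1# / ι 22) * (T (ι 3) (ι 1) (ι 3) k * k!⁻¹) ∎
  where
  open Field F
  open FieldDefs F
  open FieldLemmas F
  open DistinctRoots α β γ α-root β-root γ-root α≉β β≉γ α≉γ
  open Relation.Binary.Reasoning.Setoid setoid

  k!⁻¹ : Carrier
  k!⁻¹ = ι (k ℕ.!) ⁻¹
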